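{- Let $m\ge 3$ and let $A_m$ be an $F_m$-matrix. Then $A_m\in\mathbf{U}_m^{(0,\frac12)}$.
   Context: $I_m=\{1,\dots,m\}$. $\mathbf{U}_m$ is the set of real $m\times m$ matrices $A_m=(a_{ij})$ with $a_{ij}=a_{ji}\ge 0$ for all $i,j$ and $\sum_{i,j\in\alpha}a_{ij}\le|\alpha|$ for every $\alpha\subset I_m$ ($|\alpha|$ the cardinality). $\mathbf{U}_m^{(0,\frac12,1)}=\{A_m\in\mathbf{U}_m: a_{ii}\in\{0,1\},\ a_{ij}\in\{0,\frac12,1\}\ \forall i,j\}$ and $\mathbf{U}_m^{(0,\frac12)}=\{A_m\in\mathbf{U}_m: a_{ii}=0,\ a_{ij}\in\{0,\frac12\}\ \forall i,j\}$. A nonempty $\alpha\subset I_m$ is saturated for $A_m$ if $\sum_{i,j\in\alpha}a_{ij}=|\alpha|$. An $F_m$-matrix is a matrix $A_m\in\mathbf{U}_m^{(0,\frac12,1)}$ such that $I_m$ is saturated and no nonempty proper subset $\alpha\subsetneq I_m$ is saturated. -}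

module Defs where

open import Data.Nat using (ℕ; zero; suc)
open import Data.Fin using (Fin; zero; suc)
open import Data.Fin.Subset using (Subset; ⊤; ∣_∣; Nonempty; inside; outside)
open import Data.Vec using (lookup)
open import Data.Integer using (+_)
open import Data.Rational using (ℚ; 0ℚ; 1ℚ; ½; _+_; _≤_; _/_)
open import Data.Product using (_×_)
open import Data.Sum using (_⊎_)
open import Relation.Binary.PropositionalEquality using (_≡_; _≢_)
open import Relation.Nullary using (¬_)

-- Real symmetric matrices in this setting have entries in {0,1/2,1} for the
-- matrices concerned, so we use rational entries.
Matrix : ℕ → Set
Matrix m = Fin m → Fin m → ℚ

sumFin : ∀ {m} → (Fin m → ℚ) → ℚ
sumFin {zero}  f = 0ℚ
sumFin {suc m} f = f zero + sumFin {m} (λ i → f (suc i))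

restrict : ∀ {m} → Subset m → (Fin m → ℚ) → Fin m → ℚ
restrict α f i with lookup α i
... | inside  = f i
... | outside = 0ℚ

blockSum : ∀ {m} → Matrix m → Subset m → ℚ
blockSum A α = sumFin (restrict α (λ i → sumFin (restrict α (λ j → A i j))))

card : ∀ {m} → Subset m → ℚ
card α = + ∣ α ∣ / 1

InU : ∀ {m} → Matrix m → Set
InU {m} A =
  (∀ i j → A i j ≡ A j i) ×
  (∀ i j → 0ℚ ≤ A i j) ×
  (∀ (α : Subset m) → blockSum A α ≤ card α)

InU01 : ∀ {m} → Matrix m → Set
InU01 A =
  InU A ×
  (∀ i → (A i i ≡ 0ℚ) ⊎ (A i i ≡ 1ℚ)) ×
  (∀ i j → (A i j ≡ 0ℚ) ⊎ (A i j ≡ ½) ⊎ (A i j ≡ 1ℚ))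

InU0½ : ∀ {m} → Matrix m → Set
InU0½ A =
  InU A ×
  (∀ i → A i i ≡ 0ℚ) ×
  (∀ i j → (A i j ≡ 0ℚ) ⊎ (A i j ≡ ½))

Saturated : ∀ {m} → Matrix m → Subset m → Set
Saturated A α = Nonempty α × (blockSum A α ≡ card α)

IsFMatrix : ∀ {m} → Matrix m → Set
IsFMatrix {m} A =
  InU01 A ×
  Saturated A ⊤ ×
  (∀ (α : Subset m) → Nonempty α → α ≢ ⊤ → ¬ Saturated A α)

module Submission where

-- A diagonal entry 1 would make {i} saturated, and (once the diagonal is known
-- to vanish) an off-diagonal entry a_ij = a_ji = 1 would make {i,j} saturated,
-- since its block sum is 0 + 1 + 1 + 0 = 2. For m ≥ 3 both sets are proper, so
-- an F_m-matrix has neither.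

open import Defs
open import Data.Nat using (ℕ; _≥_; _<_; _≤_; zero; suc)
open import Data.Nat.Properties using (<⇒≢; ≤-trans; n≤1+n)
open import Data.Fin using (Fin; zero; suc; _≟_)
open import Data.Fin.Subset using (Subset; ⊤; ⊥; ∣_∣; inside; outside; ⁅_⁆; _∪_)
open import Data.Fin.Subset.Properties using (∣⁅x⁆∣≡1; ∣⊤∣≡n; x∈⁅x⁆; ∪-identityˡ; ∪-identityʳ; x∈p∪q⁺)
open import Data.Vec using (_∷_; lookup)
open import Data.Rational using (ℚ; 0ℚ; 1ℚ; ½; _+_; _/_)
open import Data.Rational.Properties using (+-identityˡ; +-identityʳ; +-comm; 1≢0)
open import Data.Product using (_,_)
open import Data.Sum using (_⊎_; inj₁; inj₂)
open import Data.Empty using (⊥-elim)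
open import Data.Integer using (+_)
open import Function using (_∘_)
open import Relation.Binary.PropositionalEquality
open import Relation.Nullary using (¬_; yes; no)

sumFin-cong : ∀ {m} {f g : Fin m → ℚ} → (∀ i → f i ≡ g i) → sumFin f ≡ sumFin g
sumFin-cong {zero}  f≗g = refl
sumFin-cong {suc m} f≗g = cong₂ _+_ (f≗g zero) (sumFin-cong (λ i → f≗g (suc i)))

restrict-∷-suc : ∀ {m} x (p : Subset m) (f : Fin (suc m) → ℚ) i →
                 restrict (x ∷ p) f (suc i) ≡ restrict p (λ k → f (suc k)) i
restrict-∷-suc x p f i with lookup p i
... | inside  = refl
... | outside = refl

sumFin-restrict-∷ : ∀ {m} x (p : Subset m) (f : Fin (suc m) → ℚ) →
                    sumFin (restrict (x ∷ p) f) ≡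
                    restrict (x ∷ p) f zero + sumFin (restrict p (λ k → f (suc k)))
sumFin-restrict-∷ x p f = cong (_+_ (restrict (x ∷ p) f zero)) (sumFin-cong (restrict-∷-suc x p f))

sumFin-restrict-⊥ : ∀ {m} (f : Fin m → ℚ) → sumFin (restrict ⊥ f) ≡ 0ℚ
sumFin-restrict-⊥ {zero}  f = refl
sumFin-restrict-⊥ {suc m} f = begin
  sumFin (restrict ⊥ f)                      ≡⟨ sumFin-restrict-∷ outside ⊥ f ⟩
  0ℚ + sumFin (restrict ⊥ (λ k → f (suc k))) ≡⟨ +-identityˡ _ ⟩
  sumFin (restrict ⊥ (λ k → f (suc k)))      ≡⟨ sumFin-restrict-⊥ (λ k → f (suc k)) ⟩
  0ℚ                                         ∎
  where open ≡-Reasoning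

sumFin-restrict-⁅⁆ : ∀ {m} (i : Fin m) (f : Fin m → ℚ) → sumFin (restrict ⁅ i ⁆ f) ≡ f i
sumFin-restrict-⁅⁆ zero f = begin
  sumFin (restrict ⁅ zero ⁆ f)                  ≡⟨ sumFin-restrict-∷ inside ⊥ f ⟩
  f zero + sumFin (restrict ⊥ (λ k → f (suc k))) ≡⟨ cong (_+_ (f zero)) (sumFin-restrict-⊥ (λ k → f (suc k))) ⟩
  f zero + 0ℚ                                   ≡⟨ +-identityʳ _ ⟩
  f zero                                        ∎
  where open ≡-Reasoning
sumFin-restrict-⁅⁆ (suc i) f =
  trans (sumFin-restrict-∷ outside ⁅ i ⁆ f)
        (trans (+-identityˡ _) (sumFin-restrict-⁅⁆ i (λ k → f (suc k))))

sumFin-restrict-⁅⁆∪⁅⁆ : ∀ {m} {i j : Fin m} → i ≢ j → (f : Fin m → ℚ) →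
                        sumFin (restrict (⁅ i ⁆ ∪ ⁅ j ⁆) f) ≡ f i + f j
sumFin-restrict-⁅⁆∪⁅⁆ {i = zero} {zero} i≢j f = ⊥-elim (i≢j refl)
sumFin-restrict-⁅⁆∪⁅⁆ {i = zero} {suc j} _ f =
  trans (sumFin-restrict-∷ inside (⊥ ∪ ⁅ j ⁆) f)
        (cong (_+_ (f zero)) (trans (cong (λ p → sumFin (restrict p _)) (∪-identityˡ ⁅ j ⁆))
                                    (sumFin-restrict-⁅⁆ j _)))
sumFin-restrict-⁅⁆∪⁅⁆ {i = suc i} {zero} _ f =
  trans (sumFin-restrict-∷ inside (⁅ i ⁆ ∪ ⊥) f)
        (trans (cong (_+_ (f zero)) (trans (cong (λ p → sumFin (restrict p _)) (∪-identityʳ ⁅ i ⁆))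
                                           (sumFin-restrict-⁅⁆ i _)))
               (+-comm (f zero) (f (suc i))))
sumFin-restrict-⁅⁆∪⁅⁆ {i = suc i} {suc j} i≢j f =
  trans (sumFin-restrict-∷ outside (⁅ i ⁆ ∪ ⁅ j ⁆) f)
        (trans (+-identityˡ _) (sumFin-restrict-⁅⁆∪⁅⁆ (i≢j ∘ cong suc) (λ k → f (suc k))))

blockSum-⁅⁆ : ∀ {m} (A : Matrix m) (i : Fin m) → blockSum A ⁅ i ⁆ ≡ A i i
blockSum-⁅⁆ A i = trans (sumFin-restrict-⁅⁆ i _) (sumFin-restrict-⁅⁆ i (A i))

blockSum-⁅⁆∪⁅⁆ : ∀ {m} (A : Matrix m) {i j : Fin m} → i ≢ j →
                 blockSum A (⁅ i ⁆ ∪ ⁅ j ⁆) ≡ (A i i + A i j) + (A j i + A j j)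
blockSum-⁅⁆∪⁅⁆ A i≢j =
  trans (sumFin-restrict-⁅⁆∪⁅⁆ i≢j _)
        (cong₂ _+_ (sumFin-restrict-⁅⁆∪⁅⁆ i≢j _) (sumFin-restrict-⁅⁆∪⁅⁆ i≢j _))

∣⁅x⁆∪⁅y⁆∣≡2 : ∀ {m} {i j : Fin m} → i ≢ j → ∣ ⁅ i ⁆ ∪ ⁅ j ⁆ ∣ ≡ 2
∣⁅x⁆∪⁅y⁆∣≡2 {i = zero}  {zero}  i≢j = ⊥-elim (i≢j refl)
∣⁅x⁆∪⁅y⁆∣≡2 {i = zero}  {suc j} _   = cong suc (trans (cong ∣_∣ (∪-identityˡ ⁅ j ⁆)) (∣⁅x⁆∣≡1 j))
∣⁅x⁆∪⁅y⁆∣≡2 {i = suc i} {zero}  _   = cong suc (trans (cong ∣_∣ (∪-identityʳ ⁅ i ⁆)) (∣⁅x⁆∣≡1 i))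
∣⁅x⁆∪⁅y⁆∣≡2 {i = suc i} {suc j} i≢j = ∣⁅x⁆∪⁅y⁆∣≡2 (i≢j ∘ cong suc)

∣p∣<n⇒p≢⊤ : ∀ {n} {p : Subset n} → ∣ p ∣ < n → p ≢ ⊤
∣p∣<n⇒p≢⊤ {n} ∣p∣<n p≡⊤ = <⇒≢ ∣p∣<n (trans (cong ∣_∣ p≡⊤) (∣⊤∣≡n n))

IsFMatrix⇒¬Saturated : ∀ {m} {A : Matrix m} → IsFMatrix A →
                       (α : Subset m) → ∣ α ∣ < m → ¬ Saturated A α
IsFMatrix⇒¬Saturated (_ , _ , noProperSaturated) α ∣α∣<m sat@(nonempty , _) =
  noProperSaturated α nonempty (∣p∣<n⇒p≢⊤ ∣α∣<m) sat

IsFMatrix⇒diagonal≡0 : ∀ {m} → 2 ≤ m → {A : Matrix m} → IsFMatrix A → ∀ i → A i i ≡ 0ℚ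
IsFMatrix⇒diagonal≡0 {m} m≥2 {A} F@((_ , diagonal , _) , _) i with diagonal i
... | inj₁ Aii≡0 = Aii≡0
... | inj₂ Aii≡1 = ⊥-elim (IsFMatrix⇒¬Saturated F ⁅ i ⁆ ∣⁅i⁆∣<m ((i , x∈⁅x⁆ i) , ⁅i⁆-saturated))
  where
  ∣⁅i⁆∣<m : ∣ ⁅ i ⁆ ∣ < m
  ∣⁅i⁆∣<m = subst (_< m) (sym (∣⁅x⁆∣≡1 i)) m≥2
  ⁅i⁆-saturated : blockSum A ⁅ i ⁆ ≡ card ⁅ i ⁆
  ⁅i⁆-saturated = trans (blockSum-⁅⁆ A i) (trans Aii≡1 (cong (λ n → + n / 1) (sym (∣⁅x⁆∣≡1 i))))

IsFMatrix⇒offDiagonal≢1 : ∀ {m} → 3 ≤ m → {A : Matrix m} → IsFMatrix A →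
                          ∀ {i j} → i ≢ j → A i j ≢ 1ℚ
IsFMatrix⇒offDiagonal≢1 {m} m≥3 {A} F@(((symmetric , _) , _) , _) {i} {j} i≢j Aij≡1 =
  IsFMatrix⇒¬Saturated F ⁅i,j⁆ ∣⁅i,j⁆∣<m ((i , x∈p∪q⁺ (inj₁ (x∈⁅x⁆ i))) , ⁅i,j⁆-saturated)
  where
  ⁅i,j⁆ : Subset m
  ⁅i,j⁆ = ⁅ i ⁆ ∪ ⁅ j ⁆
  ∣⁅i,j⁆∣<m : ∣ ⁅i,j⁆ ∣ < m
  ∣⁅i,j⁆∣<m = subst (_< m) (sym (∣⁅x⁆∪⁅y⁆∣≡2 i≢j)) m≥3
  diagonal≡0 : ∀ k → A k k ≡ 0ℚ
  diagonal≡0 = IsFMatrix⇒diagonal≡0 (≤-trans (n≤1+n 2) m≥3) F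
  ⁅i,j⁆-saturated : blockSum A ⁅i,j⁆ ≡ card ⁅i,j⁆
  ⁅i,j⁆-saturated = begin
    blockSum A ⁅i,j⁆                  ≡⟨ blockSum-⁅⁆∪⁅⁆ A i≢j ⟩
    (A i i + A i j) + (A j i + A j j) ≡⟨ cong₂ _+_ (cong₂ _+_ (diagonal≡0 i) Aij≡1)
                                                   (cong₂ _+_ (trans (symmetric j i) Aij≡1) (diagonal≡0 j)) ⟩
    (0ℚ + 1ℚ) + (1ℚ + 0ℚ)             ≡⟨ cong (λ n → + n / 1) (sym (∣⁅x⁆∪⁅y⁆∣≡2 i≢j)) ⟩
    card ⁅i,j⁆                        ∎
    where open ≡-Reasoning

proposition3p5 : (m : ℕ) → m ≥ 3 → (A : Matrix m) → IsFMatrix A → InU0½ A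
proposition3p5 m m≥3 A F@((inU , _ , entries) , _) = inU , diagonal≡0 , entries∈⦃0,½⦄
  where
  diagonal≡0 : ∀ i → A i i ≡ 0ℚ
  diagonal≡0 = IsFMatrix⇒diagonal≡0 (≤-trans (n≤1+n 2) m≥3) F
  entries∈⦃0,½⦄ : ∀ i j → (A i j ≡ 0ℚ) ⊎ (A i j ≡ ½)
  entries∈⦃0,½⦄ i j with entries i j | i ≟ j
  ... | inj₁ Aij≡0        | _        = inj₁ Aij≡0
  ... | inj₂ (inj₁ Aij≡½) | _        = inj₂ Aij≡½
  ... | inj₂ (inj₂ Aij≡1) | yes refl = ⊥-elim (1≢0 (trans (sym Aij≡1) (diagonal≡0 i)))
  ... | inj₂ (inj₂ Aij≡1) | no i≢j   = ⊥-elim (IsFMatrix⇒offDiagonal≢1 m≥3 F i≢j Aij≡1)
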